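{- Let $\Gamma$ be a graph on $v\ge3$ vertices that is not a complete multipartite graph. Then $v+\bar\lambda-2\bar k>0$.
   Context: Complete graphs and edgeless graphs count as complete multipartite graphs. For a graph $\Gamma=(V,E)$ on $v$ vertices, $\bar k=2|E|/v$ is the average degree, $N$ is the number of triangles of $\Gamma$, and $\bar\lambda=\frac{6N}{v\bar k}$. -}

module Defs where

open import Data.Bool using (Bool; true; false; if_then_else_; _∧_)
open import Data.Nat as ℕ using (ℕ; _<ᵇ_)
open import Data.Fin using (Fin; toℕ)
open import Data.List using (List; length; filter; allFin; concatMap; map; _∷_; [])
open import Data.Product using (_×_; _,_; Σ; ∃)
open import Relation.Binary.PropositionalEquality using (_≡_; _≢_)
open import Relation.Nullary using (¬_; yes; no)
import Data.Rational as ℚ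
open ℚ using (ℚ; 0ℚ; _÷_; _≟_; ≢-nonZero)
open import Data.Integer using (+_)
open import Function using (_⇔_)

record Graph (v : ℕ) : Set where
  field
    adj    : Fin v → Fin v → Bool
    sym    : ∀ i j → adj i j ≡ adj j i
    irrefl : ∀ i → adj i i ≡ false
open Graph public

keep : {A : Set} → (A → Bool) → List A → List A
keep p [] = []
keep p (x ∷ xs) = if p x then x ∷ keep p xs else keep p xs

private
  pairs : ∀ {v} → List (Fin v × Fin v)
  pairs {v} = concatMap (λ i → map (λ j → i , j) (allFin v)) (allFin v)

  triples : ∀ {v} → List (Fin v × Fin v × Fin v)
  triples {v} = concatMap (λ i → concatMap (λ j → map (λ k → i , j , k) (allFin v)) (allFin v)) (allFin v)

numEdges : ∀ {v} → Graph v → ℕ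
numEdges {v} G =
  length (keep (λ { (i , j) → (toℕ i <ᵇ toℕ j) ∧ adj G i j }) pairs)

numTriangles : ∀ {v} → Graph v → ℕ
numTriangles {v} G =
  length (keep
    (λ { (i , j , k) → (toℕ i <ᵇ toℕ j) ∧ (toℕ j <ᵇ toℕ k)
                        ∧ adj G i j ∧ adj G j k ∧ adj G i k })
    triples)

fromℕℚ : ℕ → ℚ
fromℕℚ n = (+ n) ℚ./ 1

-- Total division on ℚ with the convention p / 0 = 0 (only used where the
-- denominator is nonzero under the theorem's hypotheses).
_/'_ : ℚ → ℚ → ℚ
p /' q with q ≟ 0ℚ
... | yes _  = 0ℚ
... | no q≢0 = _÷_ p q {{≢-nonZero q≢0}}

kbar : ∀ {v} → Graph v → ℚ
kbar {v} G = (fromℕℚ 2 ℚ.* fromℕℚ (numEdges G)) /' fromℕℚ v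

lambdabar : ∀ {v} → Graph v → ℚ
lambdabar {v} G = (fromℕℚ 6 ℚ.* fromℕℚ (numTriangles G)) /' (fromℕℚ v ℚ.* kbar G)

-- Complete graphs (injective labelling) and
-- edgeless graphs (constant labelling) are included.
CompleteMultipartite : ∀ {v} → Graph v → Set
CompleteMultipartite {v} G =
  Σ (Fin v → ℕ) λ part → ∀ i j → (adj G i j ≡ true) ⇔ (part i ≢ part j)

-- Let D = Σᵢ dᵢ = 2|E| and T = Σᵢⱼₖ aᵢⱼ aⱼₖ aᵢₖ = 6N.  For an edge ij and any vertex k,
-- [k ~ i] + [k ~ j] ≤ [k ~ i][k ~ j] + 1; summed over ordered triples this gives
-- 2 Σᵢ dᵢ² ≤ T + vD, strictly as soon as some vertex is adjacent to neither end of some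
-- edge, i.e. as soon as Γ has an induced K₂ + K₁.  Graphs without an induced K₂ + K₁ are
-- complete multipartite, because non-adjacency is then an equivalence relation.  With
-- Cauchy–Schwarz, D² ≤ v Σᵢ dᵢ², we get 2D² < v²D + vT, which is v + λ̄ − 2k̄ > 0
-- multiplied by vD, since k̄ = D/v and λ̄ = T/D.

module Submission where

open import Defs using (Graph)

module Sums where

  open import Data.Nat
  open import Data.Nat.Properties
  open import Data.Nat.Tactic.RingSolver using (solve-∀)
  open import Data.Fin using (Fin; zero; suc)
  open import Data.Product using (_,_)
  open import Data.Sum using ([_,_]′)
  open import Function using (_∘_)
  open import Relation.Binary.PropositionalEquality
  open import Algebra.Properties.Semiring.Sum +-*-semiring public
    using (sum; sum-syntax; sum-cong-≗; ∑-comm; ∑-distrib-+; *-distribˡ-sum; *-distribʳ-sum)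

  ∑-const : ∀ n c → ∑[ i < n ] c ≡ n * c
  ∑-const zero    c = refl
  ∑-const (suc n) c = cong (c +_) (∑-const n c)

  ∑-mono-≤ : ∀ {n} {f g : Fin n → ℕ} → (∀ i → f i ≤ g i) → sum f ≤ sum g
  ∑-mono-≤ {zero}  f≤g = z≤n
  ∑-mono-≤ {suc n} f≤g = +-mono-≤ (f≤g zero) (∑-mono-≤ (f≤g ∘ suc))

  ∑-mono-< : ∀ {n} {f g : Fin n → ℕ} → (∀ i → f i ≤ g i) → ∀ x → f x < g x → sum f < sum g
  ∑-mono-< f≤g zero    fx<gx = +-mono-<-≤ fx<gx (∑-mono-≤ (f≤g ∘ suc))
  ∑-mono-< f≤g (suc x) fx<gx = +-mono-≤-< (f≤g zero) (∑-mono-< (f≤g ∘ suc) x fx<gx)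

  f≤∑f : ∀ {n} (f : Fin n → ℕ) x → f x ≤ sum f
  f≤∑f f zero    = m≤m+n _ _
  f≤∑f f (suc x) = ≤-trans (f≤∑f (f ∘ suc) x) (m≤n+m _ _)

  2*m*n≤m*m+n*n : ∀ m n → 2 * (m * n) ≤ m * m + n * n
  2*m*n≤m*m+n*n m n =
    [ ordered , (λ n≤m → subst₂ _≤_ (cong (2 *_) (*-comm n m)) (+-comm (n * n) (m * m)) (ordered n≤m)) ]′
    (≤-total m n)
    where
    ordered : ∀ {m n} → m ≤ n → 2 * (m * n) ≤ m * m + n * n
    ordered {m} m≤n with m≤n⇒∃[o]m+o≡n m≤n
    ... | d , refl = subst (2 * (m * (m + d)) ≤_) (sym (square-gap m d)) (m≤m+n _ (d * d))
      where
      square-gap : ∀ m d → m * m + (m + d) * (m + d) ≡ 2 * (m * (m + d)) + d * d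
      square-gap = solve-∀

  cauchy-schwarz : ∀ {n} (d : Fin n → ℕ) → sum d * sum d ≤ n * ∑[ i < n ] (d i * d i)
  cauchy-schwarz {n} d = *-cancelˡ-≤ 2 (begin
    2 * (sum d * sum d)                              ≡⟨ cross-terms ⟩
    ∑[ i < n ] ∑[ j < n ] (2 * (d i * d j))          ≤⟨ ∑-mono-≤ (λ i → ∑-mono-≤ (λ j → 2*m*n≤m*m+n*n (d i) (d j))) ⟩
    ∑[ i < n ] ∑[ j < n ] (d i * d i + d j * d j)    ≡⟨ squares ⟩
    2 * (n * sum²) ∎)
    where
    open ≤-Reasoning
    sum² : ℕ
    sum² = ∑[ i < n ] (d i * d i)
    cross-terms : 2 * (sum d * sum d) ≡ ∑[ i < n ] ∑[ j < n ] (2 * (d i * d j))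
    cross-terms = begin-equality
      2 * (sum d * sum d)                        ≡⟨ cong (2 *_) (*-distribʳ-sum (sum d) d) ⟩
      2 * ∑[ i < n ] (d i * sum d)               ≡⟨ cong (2 *_) (sum-cong-≗ (λ i → *-distribˡ-sum (d i) d)) ⟩
      2 * ∑[ i < n ] ∑[ j < n ] (d i * d j)      ≡⟨ *-distribˡ-sum 2 (λ i → ∑[ j < n ] (d i * d j)) ⟩
      ∑[ i < n ] (2 * ∑[ j < n ] (d i * d j))    ≡⟨ sum-cong-≗ (λ i → *-distribˡ-sum 2 (λ j → d i * d j)) ⟩
      ∑[ i < n ] ∑[ j < n ] (2 * (d i * d j))    ∎
    squares : ∑[ i < n ] ∑[ j < n ] (d i * d i + d j * d j) ≡ 2 * (n * sum²)
    squares = begin-equality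
      ∑[ i < n ] ∑[ j < n ] (d i * d i + d j * d j)            ≡⟨ sum-cong-≗ (λ i → ∑-distrib-+ (λ _ → d i * d i) (λ j → d j * d j)) ⟩
      ∑[ i < n ] (∑[ j < n ] (d i * d i) + sum²)               ≡⟨ ∑-distrib-+ (λ i → ∑[ j < n ] (d i * d i)) (λ _ → sum²) ⟩
      ∑[ i < n ] ∑[ j < n ] (d i * d i) + ∑[ i < n ] sum²      ≡⟨ cong₂ _+_ (sum-cong-≗ (λ i → ∑-const n (d i * d i))) (∑-const n sum²) ⟩
      ∑[ i < n ] (n * (d i * d i)) + n * sum²                  ≡⟨ cong (_+ n * sum²) (*-distribˡ-sum n (λ i → d i * d i)) ⟨
      n * sum² + n * sum²                                      ≡⟨ cong (n * sum² +_) (+-identityʳ (n * sum²)) ⟨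
      2 * (n * sum²)                                           ∎

  ∑² : ∀ {n} → (Fin n → Fin n → ℕ) → ℕ
  ∑² {n} f = ∑[ i < n ] ∑[ j < n ] f i j

  ∑³ : ∀ {n} → (Fin n → Fin n → Fin n → ℕ) → ℕ
  ∑³ {n} f = ∑[ i < n ] ∑[ j < n ] ∑[ k < n ] f i j k

  ∑²-cong : ∀ {n} {f g : Fin n → Fin n → ℕ} → (∀ i j → f i j ≡ g i j) → ∑² f ≡ ∑² g
  ∑²-cong f≡g = sum-cong-≗ (λ i → sum-cong-≗ (f≡g i))

  ∑³-cong : ∀ {n} {f g : Fin n → Fin n → Fin n → ℕ} → (∀ i j k → f i j k ≡ g i j k) → ∑³ f ≡ ∑³ g
  ∑³-cong f≡g = sum-cong-≗ (λ i → ∑²-cong (f≡g i))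

  ∑²-distrib-+ : ∀ {n} (f g : Fin n → Fin n → ℕ) → ∑² (λ i j → f i j + g i j) ≡ ∑² f + ∑² g
  ∑²-distrib-+ {n} f g =
    trans (sum-cong-≗ (λ i → ∑-distrib-+ (f i) (g i))) (∑-distrib-+ (λ i → sum (f i)) (λ i → sum (g i)))

  ∑³-distrib-+ : ∀ {n} (f g : Fin n → Fin n → Fin n → ℕ) → ∑³ (λ i j k → f i j k + g i j k) ≡ ∑³ f + ∑³ g
  ∑³-distrib-+ {n} f g =
    trans (sum-cong-≗ (λ i → ∑²-distrib-+ (f i) (g i))) (∑-distrib-+ (λ i → ∑² (f i)) (λ i → ∑² (g i)))

  ∑³-mono-< : ∀ {n} {f g : Fin n → Fin n → Fin n → ℕ} → (∀ i j k → f i j k ≤ g i j k) →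
              ∀ x y z → f x y z < g x y z → ∑³ f < ∑³ g
  ∑³-mono-< f≤g x y z fxyz<gxyz =
    ∑-mono-< (λ i → ∑-mono-≤ (λ j → ∑-mono-≤ (f≤g i j))) x
      (∑-mono-< (λ j → ∑-mono-≤ (f≤g x j)) y
        (∑-mono-< (f≤g x y) z fxyz<gxyz))

  ∑³-swap₁₂ : ∀ {n} (f : Fin n → Fin n → Fin n → ℕ) → ∑³ f ≡ ∑³ (λ i j k → f j i k)
  ∑³-swap₁₂ {n} f = ∑-comm (λ i j → ∑[ k < n ] f i j k)

  ∑³-swap₂₃ : ∀ {n} (f : Fin n → Fin n → Fin n → ℕ) → ∑³ f ≡ ∑³ (λ i j k → f i k j)
  ∑³-swap₂₃ f = sum-cong-≗ (λ i → ∑-comm (f i))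

  ∑²-symmetrise : ∀ {n} (h : Fin n → Fin n → ℕ) → ∑² (λ i j → h i j + h j i) ≡ 2 * ∑² h
  ∑²-symmetrise h = begin
    ∑² (λ i j → h i j + h j i)      ≡⟨ ∑²-distrib-+ h (λ i j → h j i) ⟩
    ∑² h + ∑² (λ i j → h j i)       ≡⟨ cong (∑² h +_) (∑-comm h) ⟨
    ∑² h + ∑² h                     ≡⟨ cong (∑² h +_) (+-identityʳ (∑² h)) ⟨
    2 * ∑² h                        ∎
    where open ≡-Reasoning

  ∑³-symmetrise : ∀ {n} (h : Fin n → Fin n → Fin n → ℕ) →
    ∑³ (λ i j k → h i j k + h i k j + h j i k + h j k i + h k i j + h k j i) ≡ 6 * ∑³ h
  ∑³-symmetrise h = begin
    ∑³ (λ i j k → h i j k + h i k j + h j i k + h j k i + h k i j + h k j i)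
      ≡⟨ split ⟩
    ∑³ h + ∑³ (λ i j k → h i k j) + ∑³ (λ i j k → h j i k)
         + ∑³ (λ i j k → h j k i) + ∑³ (λ i j k → h k i j) + ∑³ (λ i j k → h k j i)
      ≡⟨ cong₂ _+_ (cong₂ _+_ (cong₂ _+_ (cong₂ _+_ (cong (∑³ h +_) ikj) jik) jki) kij) kji ⟩
    ∑³ h + ∑³ h + ∑³ h + ∑³ h + ∑³ h + ∑³ h
      ≡⟨ six-copies (∑³ h) ⟩
    6 * ∑³ h ∎
    where
    open ≡-Reasoning
    split = trans (∑³-distrib-+ (λ i j k → h i j k + h i k j + h j i k + h j k i + h k i j) (λ i j k → h k j i))
      (cong (_+ ∑³ (λ i j k → h k j i)) (trans (∑³-distrib-+ (λ i j k → h i j k + h i k j + h j i k + h j k i) (λ i j k → h k i j))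
        (cong (_+ ∑³ (λ i j k → h k i j)) (trans (∑³-distrib-+ (λ i j k → h i j k + h i k j + h j i k) (λ i j k → h j k i))
          (cong (_+ ∑³ (λ i j k → h j k i)) (trans (∑³-distrib-+ (λ i j k → h i j k + h i k j) (λ i j k → h j i k))
            (cong (_+ ∑³ (λ i j k → h j i k)) (∑³-distrib-+ h (λ i j k → h i k j)))))))))
    ikj : ∑³ (λ i j k → h i k j) ≡ ∑³ h
    ikj = sym (∑³-swap₂₃ h)
    jik : ∑³ (λ i j k → h j i k) ≡ ∑³ h
    jik = sym (∑³-swap₁₂ h)
    jki : ∑³ (λ i j k → h j k i) ≡ ∑³ h
    jki = trans (∑³-swap₁₂ (λ i j k → h j k i)) ikj
    kij : ∑³ (λ i j k → h k i j) ≡ ∑³ h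
    kij = trans (∑³-swap₂₃ (λ i j k → h k i j)) jik
    kji : ∑³ (λ i j k → h k j i) ≡ ∑³ h
    kji = trans (∑³-swap₁₂ (λ i j k → h k j i)) kij
    six-copies : ∀ m → m + m + m + m + m + m ≡ 6 * m
    six-copies = solve-∀

module Indicators where

  open import Data.Bool using (Bool; true; false; _∧_)
  open import Data.Nat
  open import Data.Nat.Properties using (+-identityʳ; ≤-refl)
  open import Relation.Binary.PropositionalEquality

  𝟙 : Bool → ℕ
  𝟙 true  = 1
  𝟙 false = 0

  𝟙-∧ : ∀ a b → 𝟙 (a ∧ b) ≡ 𝟙 a * 𝟙 b
  𝟙-∧ true  b = sym (+-identityʳ (𝟙 b))
  𝟙-∧ false b = refl

  𝟙-wedge : ∀ p q r → 𝟙 p * 𝟙 q + 𝟙 p * 𝟙 r ≤ 𝟙 p * (𝟙 r * 𝟙 q) + 𝟙 p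
  𝟙-wedge true  true  true  = ≤-refl
  𝟙-wedge true  true  false = ≤-refl
  𝟙-wedge true  false true  = ≤-refl
  𝟙-wedge true  false false = z≤n
  𝟙-wedge false q     r     = z≤n

  𝟙-wedge-< : ∀ {p q r} → p ≡ true → q ≡ false → r ≡ false → 𝟙 p * 𝟙 q + 𝟙 p * 𝟙 r < 𝟙 p * (𝟙 r * 𝟙 q) + 𝟙 p
  𝟙-wedge-< refl refl refl = s≤s z≤n

module Orderings where

  open import Data.Bool using (true; false; not)
  open import Data.Nat
  open import Data.Nat.Properties
  open import Data.Nat.Tactic.RingSolver using (solve-∀)
  open import Data.Fin as Fin using (Fin; toℕ)
  open import Data.Fin.Properties using (toℕ-injective)
  open import Function using (_∘_)
  open import Relation.Nullary using (yes; no; contradiction)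
  open import Relation.Nullary.Reflects using (ofʸ; ofⁿ)
  open import Relation.Binary.PropositionalEquality
  open Sums
  open Indicators using (𝟙)

  <ᵇ-flip : ∀ {m n} → m ≢ n → (n <ᵇ m) ≡ not (m <ᵇ n)
  <ᵇ-flip {m} {n} m≢n with m <ᵇ n | <ᵇ-reflects-< m n | n <ᵇ m | <ᵇ-reflects-< n m
  ... | true  | ofʸ m<n | true  | ofʸ n<m = contradiction n<m (<⇒≯ m<n)
  ... | true  | _       | false | _       = refl
  ... | false | _       | true  | _       = refl
  ... | false | ofⁿ m≮n | false | ofⁿ n≮m = contradiction (≤-antisym (≮⇒≥ n≮m) (≮⇒≥ m≮n)) m≢n

  𝟙< : ∀ {n} → Fin n → Fin n → ℕ
  𝟙< i j = 𝟙 (toℕ i <ᵇ toℕ j)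

  𝟙<< : ∀ {n} → Fin n → Fin n → Fin n → ℕ
  𝟙<< i j k = 𝟙< i j * 𝟙< j k

  𝟙<-pair : ∀ {n} {i j : Fin n} → i ≢ j → 𝟙< i j + 𝟙< j i ≡ 1
  𝟙<-pair {i = i} {j} i≢j rewrite <ᵇ-flip (i≢j ∘ toℕ-injective) with toℕ i <ᵇ toℕ j
  ... | true  = refl
  ... | false = refl

  𝟙<<-partition : ∀ {n} {i j k : Fin n} → i ≢ j → j ≢ k → i ≢ k →
    𝟙<< i j k + 𝟙<< i k j + 𝟙<< j i k + 𝟙<< j k i + 𝟙<< k i j + 𝟙<< k j i ≡ 1
  𝟙<<-partition {i = i} {j} {k} i≢j j≢k i≢k =
    partition (i≢j ∘ toℕ-injective) (j≢k ∘ toℕ-injective) (i≢k ∘ toℕ-injective)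
    where
    partition : ∀ {x y z} → x ≢ y → y ≢ z → x ≢ z →
      𝟙 (x <ᵇ y) * 𝟙 (y <ᵇ z) + 𝟙 (x <ᵇ z) * 𝟙 (z <ᵇ y) + 𝟙 (y <ᵇ x) * 𝟙 (x <ᵇ z)
        + 𝟙 (y <ᵇ z) * 𝟙 (z <ᵇ x) + 𝟙 (z <ᵇ x) * 𝟙 (x <ᵇ y) + 𝟙 (z <ᵇ y) * 𝟙 (y <ᵇ x) ≡ 1
    partition {x} {y} {z} x≢y y≢z x≢z rewrite <ᵇ-flip x≢y | <ᵇ-flip y≢z | <ᵇ-flip x≢z
      with x <ᵇ y | <ᵇ-reflects-< x y | y <ᵇ z | <ᵇ-reflects-< y z | x <ᵇ z | <ᵇ-reflects-< x z
    ... | true  | ofʸ x<y | true  | ofʸ y<z | false | ofⁿ x≮z = contradiction (<-trans x<y y<z) x≮z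
    ... | false | ofⁿ x≮y | false | ofⁿ y≮z | true  | ofʸ x<z =
      contradiction (≤-trans (≮⇒≥ y≮z) (≮⇒≥ x≮y)) (<⇒≱ x<z)
    ... | true  | _ | true  | _ | true  | _ = refl
    ... | true  | _ | false | _ | true  | _ = refl
    ... | true  | _ | false | _ | false | _ = refl
    ... | false | _ | true  | _ | true  | _ = refl
    ... | false | _ | true  | _ | false | _ = refl
    ... | false | _ | false | _ | false | _ = refl

  ∑²-over-pairs : ∀ {n} (f : Fin n → Fin n → ℕ) → (∀ i j → f i j ≡ f j i) → (∀ i → f i i ≡ 0) →
    ∑² f ≡ 2 * ∑² (λ i j → 𝟙< i j * f i j)
  ∑²-over-pairs f f-sym f-diag = trans (∑²-cong split) (∑²-symmetrise (λ i j → 𝟙< i j * f i j))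
    where
    split : ∀ i j → f i j ≡ 𝟙< i j * f i j + 𝟙< j i * f j i
    split i j with i Fin.≟ j
    ... | yes refl rewrite f-diag i = sym (cong₂ _+_ (*-zeroʳ (𝟙< i i)) (*-zeroʳ (𝟙< i i)))
    ... | no i≢j = begin
      f i j                               ≡⟨ *-identityˡ (f i j) ⟨
      1 * f i j                           ≡⟨ cong (_* f i j) (𝟙<-pair i≢j) ⟨
      (𝟙< i j + 𝟙< j i) * f i j           ≡⟨ *-distribʳ-+ (f i j) (𝟙< i j) (𝟙< j i) ⟩
      𝟙< i j * f i j + 𝟙< j i * f i j     ≡⟨ cong (λ x → 𝟙< i j * f i j + 𝟙< j i * x) (f-sym i j) ⟩
      𝟙< i j * f i j + 𝟙< j i * f j i     ∎
      where open ≡-Reasoning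

  ∑³-over-triples : ∀ {n} (f : Fin n → Fin n → Fin n → ℕ) →
    (∀ i j k → f i j k ≡ f j i k) → (∀ i j k → f i j k ≡ f i k j) → (∀ i k → f i i k ≡ 0) →
    ∑³ f ≡ 6 * ∑³ (λ i j k → 𝟙< i j * (𝟙< j k * f i j k))
  ∑³-over-triples {n} f f-sym₁₂ f-sym₂₃ f-diag = trans (∑³-cong split) (∑³-symmetrise h)
    where
    h : Fin n → Fin n → Fin n → ℕ
    h i j k = 𝟙< i j * (𝟙< j k * f i j k)

    orderings : Fin n → Fin n → Fin n → ℕ
    orderings i j k = 𝟙<< i j k + 𝟙<< i k j + 𝟙<< j i k + 𝟙<< j k i + 𝟙<< k i j + 𝟙<< k j i

    x≡c*x : ∀ {x} c → x ≡ 0 → x ≡ c * x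
    x≡c*x c refl = sym (*-zeroʳ c)

    weighted : ∀ i j k → f i j k ≡ orderings i j k * f i j k
    weighted i j k with i Fin.≟ j | j Fin.≟ k | i Fin.≟ k
    ... | yes refl | _        | _        = x≡c*x (orderings i i k) (f-diag i k)
    ... | no _     | yes refl | _        =
      x≡c*x (orderings i j j) (trans (f-sym₁₂ i j j) (trans (f-sym₂₃ j i j) (f-diag j i)))
    ... | no _     | no _     | yes refl = x≡c*x (orderings i j i) (trans (f-sym₂₃ i j i) (f-diag i j))
    ... | no i≢j   | no j≢k   | no i≢k   =
      sym (trans (cong (_* f i j k) (𝟙<<-partition i≢j j≢k i≢k)) (*-identityˡ (f i j k)))

    collect : ∀ {x x₁ x₂ x₃ x₄ x₅} → x₁ ≡ x → x₂ ≡ x → x₃ ≡ x → x₄ ≡ x → x₅ ≡ x →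
      ∀ a₀ b₀ a₁ b₁ a₂ b₂ a₃ b₃ a₄ b₄ a₅ b₅ →
      (a₀ * b₀ + a₁ * b₁ + a₂ * b₂ + a₃ * b₃ + a₄ * b₄ + a₅ * b₅) * x ≡
      a₀ * (b₀ * x) + a₁ * (b₁ * x₁) + a₂ * (b₂ * x₂) + a₃ * (b₃ * x₃) + a₄ * (b₄ * x₄) + a₅ * (b₅ * x₅)
    collect {x} refl refl refl refl refl a₀ b₀ a₁ b₁ a₂ b₂ a₃ b₃ a₄ b₄ a₅ b₅ =
      distrib a₀ b₀ a₁ b₁ a₂ b₂ a₃ b₃ a₄ b₄ a₅ b₅ x
      where
      distrib : ∀ a₀ b₀ a₁ b₁ a₂ b₂ a₃ b₃ a₄ b₄ a₅ b₅ x →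
        (a₀ * b₀ + a₁ * b₁ + a₂ * b₂ + a₃ * b₃ + a₄ * b₄ + a₅ * b₅) * x ≡
        a₀ * (b₀ * x) + a₁ * (b₁ * x) + a₂ * (b₂ * x) + a₃ * (b₃ * x) + a₄ * (b₄ * x) + a₅ * (b₅ * x)
      distrib = solve-∀

    split : ∀ i j k → f i j k ≡ h i j k + h i k j + h j i k + h j k i + h k i j + h k j i
    split i j k = trans (weighted i j k)
      (collect (sym (f-sym₂₃ i j k))
               (sym (f-sym₁₂ i j k))
               (trans (sym (f-sym₂₃ j i k)) (sym (f-sym₁₂ i j k)))
               (trans (f-sym₁₂ k i j) (sym (f-sym₂₃ i j k)))
               (trans (f-sym₂₃ k j i) (trans (f-sym₁₂ k i j) (sym (f-sym₂₃ i j k))))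
               (𝟙< i j) (𝟙< j k) (𝟙< i k) (𝟙< k j) (𝟙< j i) (𝟙< i k)
               (𝟙< j k) (𝟙< k i) (𝟙< k i) (𝟙< i j) (𝟙< k j) (𝟙< j i))

module Counting where

  open import Data.Bool using (Bool; true; false)
  open import Data.Nat as ℕ using (ℕ; _+_)
  open import Data.Nat.Properties using (+-assoc)
  open import Data.Fin using (Fin; zero; suc)
  open import Data.List using (List; _∷_; []; _++_; length; map; concatMap; tabulate; allFin)
  open import Data.Product using (_×_; _,_)
  open import Function using (_∘_; id)
  open import Relation.Binary.PropositionalEquality
  open import Defs using (keep)
  open Sums
  open Indicators using (𝟙)

  length-keep-∷ : ∀ {A : Set} (p : A → Bool) x xs → length (keep p (x ∷ xs)) ≡ 𝟙 (p x) + length (keep p xs)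
  length-keep-∷ p x xs with p x
  ... | true  = refl
  ... | false = refl

  length-keep-++ : ∀ {A : Set} (p : A → Bool) xs ys →
    length (keep p (xs ++ ys)) ≡ length (keep p xs) + length (keep p ys)
  length-keep-++ p []       ys = refl
  length-keep-++ p (x ∷ xs) ys = begin
    length (keep p (x ∷ xs ++ ys))                          ≡⟨ length-keep-∷ p x (xs ++ ys) ⟩
    𝟙 (p x) + length (keep p (xs ++ ys))                    ≡⟨ cong (𝟙 (p x) +_) (length-keep-++ p xs ys) ⟩
    𝟙 (p x) + (length (keep p xs) + length (keep p ys))     ≡⟨ +-assoc (𝟙 (p x)) _ _ ⟨
    𝟙 (p x) + length (keep p xs) + length (keep p ys)       ≡⟨ cong (_+ length (keep p ys)) (length-keep-∷ p x xs) ⟨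
    length (keep p (x ∷ xs)) + length (keep p ys)           ∎
    where open ≡-Reasoning

  length-keep-map-tabulate : ∀ {A B : Set} (p : B → Bool) (h : A → B) {n} (g : Fin n → A) →
    length (keep p (map h (tabulate g))) ≡ ∑[ i < n ] 𝟙 (p (h (g i)))
  length-keep-map-tabulate p h {ℕ.zero}  g = refl
  length-keep-map-tabulate p h {ℕ.suc n} g =
    trans (length-keep-∷ p (h (g zero)) (map h (tabulate (g ∘ suc))))
          (cong (𝟙 (p (h (g zero))) +_) (length-keep-map-tabulate p h (g ∘ suc)))

  length-keep-concatMap-tabulate : ∀ {A B : Set} (p : B → Bool) (h : A → List B) {n} (g : Fin n → A) →
    length (keep p (concatMap h (tabulate g))) ≡ ∑[ i < n ] length (keep p (h (g i)))
  length-keep-concatMap-tabulate p h {ℕ.zero}  g = refl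
  length-keep-concatMap-tabulate p h {ℕ.suc n} g =
    trans (length-keep-++ p (h (g zero)) (concatMap h (tabulate (g ∘ suc))))
          (cong (length (keep p (h (g zero))) +_) (length-keep-concatMap-tabulate p h (g ∘ suc)))

  length-keep-pairs : ∀ {n} (p : Fin n × Fin n → Bool) →
    length (keep p (concatMap (λ i → map (i ,_) (allFin n)) (allFin n))) ≡ ∑² (λ i j → 𝟙 (p (i , j)))
  length-keep-pairs {n} p = trans (length-keep-concatMap-tabulate p (λ i → map (i ,_) (allFin n)) id)
    (sum-cong-≗ λ i → length-keep-map-tabulate p (i ,_) id)

  length-keep-triples : ∀ {n} (p : Fin n × Fin n × Fin n → Bool) →
    length (keep p (concatMap (λ i → concatMap (λ j → map (λ k → i , j , k) (allFin n)) (allFin n)) (allFin n)))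
      ≡ ∑³ (λ i j k → 𝟙 (p (i , j , k)))
  length-keep-triples {n} p =
    trans (length-keep-concatMap-tabulate p (λ i → concatMap (λ j → map (λ k → i , j , k) (allFin n)) (allFin n)) id)
      (sum-cong-≗ λ i → trans (length-keep-concatMap-tabulate p (λ j → map (λ k → i , j , k) (allFin n)) id)
        (sum-cong-≗ λ j → length-keep-map-tabulate p (λ k → i , j , k) id))

module Multipartite where

  open import Data.Bool using (Bool; true; false; not; if_then_else_)
  import Data.Bool.Properties as Bool
  open import Data.Nat using (ℕ; zero; suc)
  open import Data.Fin using (Fin; zero; suc; toℕ)
  open import Data.Fin.Properties using (any?; toℕ-injective)
  open import Data.Product using (_×_; _,_; ∃-syntax)
  open import Function using (_∘_; mk⇔)
  open import Relation.Nullary using (¬_; Dec; yes; no; contradiction)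
  open import Relation.Nullary.Decidable using (_×-dec_)
  open import Relation.Binary.PropositionalEquality
  open import Defs hiding (sym)

  InducedK₂+K₁ : ∀ {v} → Graph v → Set
  InducedK₂+K₁ {v} G = ∃[ x ] ∃[ y ] ∃[ z ] adj G x y ≡ true × adj G x z ≡ false × adj G y z ≡ false

  inducedK₂+K₁? : ∀ {v} (G : Graph v) → Dec (InducedK₂+K₁ G)
  inducedK₂+K₁? G = any? λ x → any? λ y → any? λ z →
    (adj G x y Bool.≟ true) ×-dec (adj G x z Bool.≟ false) ×-dec (adj G y z Bool.≟ false)

  first : ∀ {n} → (Fin n → Bool) → ℕ
  first {zero}  p = 0
  first {suc n} p = if p zero then 0 else suc (first (p ∘ suc))

  first-cong : ∀ {n} {p q : Fin n → Bool} → (∀ i → p i ≡ q i) → first p ≡ first q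
  first-cong {zero}      p≡q = refl
  first-cong {suc n} {p} p≡q rewrite p≡q zero | first-cong {p = p ∘ suc} (p≡q ∘ suc) = refl

  first-witness : ∀ {n} (p : Fin n → Bool) x → p x ≡ true → ∃[ m ] toℕ m ≡ first p × p m ≡ true
  first-witness {suc n} p x px with p zero in p0
  ... | true = zero , refl , p0
  first-witness {suc n} p zero    px | false = contradiction (trans (sym p0) px) λ ()
  first-witness {suc n} p (suc x) px | false with first-witness (p ∘ suc) x px
  ... | m , m≡first , pm = suc m , cong suc m≡first , pm

  module _ {v} (G : Graph v) (free : ¬ InducedK₂+K₁ G) where

    -- The part of i is labelled by its first non-neighbour (i itself is one).
    part : Fin v → ℕ
    part i = first (not ∘ adj G i)

    non-adjacent⇒same-neighbours : ∀ {i j} → adj G i j ≡ false → ∀ m → adj G i m ≡ adj G j m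
    non-adjacent⇒same-neighbours {i} {j} i≁j m with adj G i m in i~m | adj G j m in j~m
    ... | true  | true  = refl
    ... | false | false = refl
    ... | true  | false = contradiction (i , m , j , i~m , i≁j , trans (Graph.sym G m j) j~m) free
    ... | false | true  =
      contradiction (j , m , i , j~m , trans (Graph.sym G j i) i≁j , trans (Graph.sym G m i) i~m) free

    adjacent⇒different-parts : ∀ i j → adj G i j ≡ true → part i ≢ part j
    adjacent⇒different-parts i j i~j same
      with first-witness (not ∘ adj G i) i (cong not (irrefl G i))
         | first-witness (not ∘ adj G j) j (cong not (irrefl G j))
    ... | m , m≡part-i , i≁m | m′ , m′≡part-j , j≁m′
      with toℕ-injective (trans m≡part-i (trans same (sym m′≡part-j)))
    ... | refl = free (i , j , m , i~j , Bool.not-injective i≁m , Bool.not-injective j≁m′)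

    different-parts⇒adjacent : ∀ i j → part i ≢ part j → adj G i j ≡ true
    different-parts⇒adjacent i j different with adj G i j in i~j
    ... | true  = refl
    ... | false = contradiction (first-cong (cong not ∘ non-adjacent⇒same-neighbours i~j)) different

    K₂+K₁-free⇒completeMultipartite : CompleteMultipartite G
    K₂+K₁-free⇒completeMultipartite =
      part , λ i j → mk⇔ (adjacent⇒different-parts i j) (different-parts⇒adjacent i j)

module Degrees {v} (G : Graph v) where

  open import Data.Bool using (_∧_)
  open import Data.Nat
  open import Data.Nat.Properties
  open import Data.Nat.Tactic.RingSolver using (solve-∀)
  open import Data.Fin using (Fin; toℕ)
  open import Data.Fin.Properties using (nonZeroIndex)
  open import Data.Product using (_,_)
  open import Relation.Binary.PropositionalEquality
  open import Algebra.Properties.CommutativeSemigroup *-commutativeSemigroup using (x∙yz≈z∙yx)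
  open import Defs hiding (sym)
  open Sums
  open Indicators
  open Orderings
  open Counting
  open Multipartite using (InducedK₂+K₁)

  A : Fin v → Fin v → ℕ
  A i j = 𝟙 (adj G i j)

  degree : Fin v → ℕ
  degree i = ∑[ j < v ] A i j

  triangle : Fin v → Fin v → Fin v → ℕ
  triangle i j k = A i j * (A j k * A i k)

  A-sym : ∀ i j → A i j ≡ A j i
  A-sym i j = cong 𝟙 (Graph.sym G i j)

  A-irrefl : ∀ i → A i i ≡ 0
  A-irrefl i = cong 𝟙 (irrefl G i)

  numEdges-as-∑ : numEdges G ≡ ∑² (λ i j → 𝟙< i j * A i j)
  numEdges-as-∑ = trans (length-keep-pairs {v} _) (∑²-cong λ i j → 𝟙-∧ (toℕ i <ᵇ toℕ j) (adj G i j))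

  numTriangles-as-∑ : numTriangles G ≡ ∑³ (λ i j k → 𝟙< i j * (𝟙< j k * triangle i j k))
  numTriangles-as-∑ = trans (length-keep-triples {v} _) (∑³-cong indicator)
    where
    indicator : ∀ i j k →
      𝟙 ((toℕ i <ᵇ toℕ j) ∧ (toℕ j <ᵇ toℕ k) ∧ adj G i j ∧ adj G j k ∧ adj G i k) ≡
      𝟙< i j * (𝟙< j k * triangle i j k)
    indicator i j k =
      trans (𝟙-∧ (toℕ i <ᵇ toℕ j) _) (cong (𝟙< i j *_)
        (trans (𝟙-∧ (toℕ j <ᵇ toℕ k) _) (cong (𝟙< j k *_)
          (trans (𝟙-∧ (adj G i j) _) (cong (A i j *_) (𝟙-∧ (adj G j k) (adj G i k)))))))

  handshake : ∑[ i < v ] degree i ≡ 2 * numEdges G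
  handshake = trans (∑²-over-pairs A A-sym A-irrefl) (cong (2 *_) (sym numEdges-as-∑))

  ∑³-triangle : ∑³ triangle ≡ 6 * numTriangles G
  ∑³-triangle = trans (∑³-over-triples triangle swap₁₂ swap₂₃ (λ i k → cong (_* (A i k * A i k)) (A-irrefl i)))
                      (cong (6 *_) (sym numTriangles-as-∑))
    where
    swap₁₂ : ∀ i j k → triangle i j k ≡ triangle j i k
    swap₁₂ i j k = cong₂ _*_ (A-sym i j) (*-comm (A j k) (A i k))
    swap₂₃ : ∀ i j k → triangle i j k ≡ triangle i k j
    swap₂₃ i j k = trans (cong (λ a → A i j * (a * A i k)) (A-sym j k)) (x∙yz≈z∙yx (A i j) (A k j) (A i k))

  ∑³-wedge-at-first : ∑³ (λ i j k → A i j * A i k) ≡ ∑[ i < v ] (degree i * degree i)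
  ∑³-wedge-at-first = sum-cong-≗ λ i →
    trans (sum-cong-≗ λ j → sym (*-distribˡ-sum (A i j) (A i))) (sym (*-distribʳ-sum (degree i) (A i)))

  ∑³-wedge-at-middle : ∑³ (λ i j k → A i j * A j k) ≡ ∑[ j < v ] (degree j * degree j)
  ∑³-wedge-at-middle = begin
    ∑³ (λ i j k → A i j * A j k)               ≡⟨ sum-cong-≗ (λ i → sum-cong-≗ λ j → *-distribˡ-sum (A i j) (A j)) ⟨
    ∑² (λ i j → A i j * degree j)              ≡⟨ ∑-comm (λ i j → A i j * degree j) ⟩
    ∑[ j < v ] ∑[ i < v ] (A i j * degree j)   ≡⟨ sum-cong-≗ (λ j → *-distribʳ-sum (degree j) (λ i → A i j)) ⟨
    ∑[ j < v ] (∑[ i < v ] A i j * degree j)   ≡⟨ sum-cong-≗ (λ j → cong (_* degree j) (sum-cong-≗ λ i → A-sym i j)) ⟩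
    ∑[ j < v ] (degree j * degree j)           ∎
    where open ≡-Reasoning

  ∑³-edge : ∑³ (λ i j k → A i j) ≡ v * ∑[ i < v ] degree i
  ∑³-edge = begin
    ∑³ (λ i j k → A i j)           ≡⟨ ∑²-cong (λ i j → ∑-const v (A i j)) ⟩
    ∑² (λ i j → v * A i j)         ≡⟨ sum-cong-≗ (λ i → *-distribˡ-sum v (A i)) ⟨
    ∑[ i < v ] (v * degree i)      ≡⟨ *-distribˡ-sum v degree ⟨
    v * ∑[ i < v ] degree i        ∎
    where open ≡-Reasoning

  sum-of-squares<triangles+v*∑degree : InducedK₂+K₁ G →
    ∑[ i < v ] (degree i * degree i) + ∑[ i < v ] (degree i * degree i) < ∑³ triangle + v * ∑[ i < v ] degree i
  sum-of-squares<triangles+v*∑degree (x , y , z , x~y , x≁z , y≁z) = subst₂ _<_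
    (trans (∑³-distrib-+ (λ i j k → A i j * A i k) (λ i j k → A i j * A j k))
           (cong₂ _+_ ∑³-wedge-at-first ∑³-wedge-at-middle))
    (trans (∑³-distrib-+ triangle (λ i j k → A i j)) (cong (∑³ triangle +_) ∑³-edge))
    (∑³-mono-< (λ i j k → 𝟙-wedge (adj G i j) (adj G i k) (adj G j k)) x y z (𝟙-wedge-< x~y x≁z y≁z))

  2*numEdges>0 : InducedK₂+K₁ G → 0 < 2 * numEdges G
  2*numEdges>0 (x , y , _ , x~y , _) = subst (0 <_) handshake (begin-strict
    0                          <⟨ z<s ⟩
    1                          ≡⟨ cong 𝟙 x~y ⟨
    A x y                      ≤⟨ f≤∑f (A x) y ⟩
    degree x                   ≤⟨ f≤∑f degree x ⟩
    ∑[ i < v ] degree i        ∎)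
    where open ≤-Reasoning

  edge-triangle-inequality : InducedK₂+K₁ G →
    2 * ((2 * numEdges G) * (2 * numEdges G)) < v * v * (2 * numEdges G) + v * (6 * numTriangles G)
  edge-triangle-inequality w@(x , _) = subst₂ (λ D T → 2 * (D * D) < v * v * D + v * T) handshake ∑³-triangle (begin-strict
    2 * (D * D)             ≤⟨ *-monoʳ-≤ 2 (cauchy-schwarz degree) ⟩
    2 * (v * Q)             ≡⟨ regroup v Q ⟩
    v * (Q + Q)             <⟨ *-monoʳ-< v {{nonZeroIndex x}} (sum-of-squares<triangles+v*∑degree w) ⟩
    v * (T + v * D)         ≡⟨ expand v T D ⟩
    v * v * D + v * T       ∎)
    where
    open ≤-Reasoning
    D = ∑[ i < v ] degree i
    Q = ∑[ i < v ] (degree i * degree i)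
    T = ∑³ triangle
    regroup : ∀ v Q → 2 * (v * Q) ≡ v * (Q + Q)
    regroup = solve-∀
    expand : ∀ v T D → v * (T + v * D) ≡ v * v * D + v * T
    expand = solve-∀

module Rationals where

  open import Data.Nat as ℕ using (ℕ)
  open import Data.Integer as ℤ using (+_)
  import Data.Integer.Properties as ℤ
  open import Data.Nat.Coprimality as Coprimality using (1-coprimeTo)
  open import Data.Rational
  open import Data.Rational.Properties
  open import Data.Rational.Solver using (module +-*-Solver)
  open import Relation.Nullary using (yes; no; contradiction)
  open import Relation.Binary.PropositionalEquality
  open import Defs using (Graph; fromℕℚ; _/'_; numEdges; numTriangles; kbar; lambdabar)

  fromℕℚ≡mkℚ : ∀ n → fromℕℚ n ≡ mkℚ (+ n) 0 (Coprimality.sym (1-coprimeTo n))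
  fromℕℚ≡mkℚ n = normalize-coprime (Coprimality.sym (1-coprimeTo n))

  fromℕℚ-+ : ∀ m n → fromℕℚ (m ℕ.+ n) ≡ fromℕℚ m + fromℕℚ n
  fromℕℚ-+ m n rewrite fromℕℚ≡mkℚ m | fromℕℚ≡mkℚ n =
    /-cong (trans (ℤ.pos-+ m n) (sym (cong₂ ℤ._+_ (ℤ.*-identityʳ (+ m)) (ℤ.*-identityʳ (+ n))))) refl

  fromℕℚ-* : ∀ m n → fromℕℚ (m ℕ.* n) ≡ fromℕℚ m * fromℕℚ n
  fromℕℚ-* m n rewrite fromℕℚ≡mkℚ m | fromℕℚ≡mkℚ n = /-cong (ℤ.pos-* m n) refl

  fromℕℚ-mono-< : ∀ {m n} → m ℕ.< n → fromℕℚ m < fromℕℚ n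
  fromℕℚ-mono-< {m} {n} m<n rewrite fromℕℚ≡mkℚ m | fromℕℚ≡mkℚ n =
    *<* (subst₂ ℤ._<_ (sym (ℤ.*-identityʳ (+ m))) (sym (ℤ.*-identityʳ (+ n))) (ℤ.+<+ m<n))

  fromℕℚ-nonNeg : ∀ n → NonNegative (fromℕℚ n)
  fromℕℚ-nonNeg n rewrite fromℕℚ≡mkℚ n = _

  fromℕℚ-≢0 : ∀ {n} → 0 ℕ.< n → fromℕℚ n ≢ 0ℚ
  fromℕℚ-≢0 0<n n≡0 = <-irrefl (sym n≡0) (fromℕℚ-mono-< 0<n)

  /'-*-cancel : ∀ p {q} → q ≢ 0ℚ → (p /' q) * q ≡ p
  /'-*-cancel p {q} q≢0 with q ≟ 0ℚ
  ... | yes q≡0 = contradiction q≡0 q≢0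
  ... | no  q≢0 = begin
    p * 1/ q * q      ≡⟨ *-assoc p (1/ q) q ⟩
    p * (1/ q * q)    ≡⟨ cong (p *_) (*-inverseˡ q) ⟩
    p * 1ℚ            ≡⟨ *-identityʳ p ⟩
    p                 ∎
    where
    open ≡-Reasoning
    instance _ = ≢-nonZero q≢0

  p<q⇒0<q-p : ∀ {p q} → p < q → 0ℚ < q - p
  p<q⇒0<q-p {p} {q} p<q = subst (_< q - p) (+-inverseʳ p) (+-monoˡ-< (- p) p<q)

  -- Multiplied by V d, the right-hand side becomes V² d + V t − c d².
  0<V+t/d-c*d/V : ∀ V d t c → V ≢ 0ℚ → d ≢ 0ℚ → NonNegative (V * d) →
    c * (d * d) < V * V * d + V * t → 0ℚ < (V + t /' (V * (d /' V))) - c * (d /' V)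
  0<V+t/d-c*d/V V d t c V≢0 d≢0 Vd≥0 bound =
    *-cancelˡ-<-nonNeg (V * d) {{Vd≥0}}
      (subst₂ _<_ (sym (*-zeroʳ (V * d))) (sym expand) (p<q⇒0<q-p bound))
    where
    open +-*-Solver
    k = d /' V
    L = t /' (V * k)
    Vk≡d : V * k ≡ d
    Vk≡d = trans (*-comm V k) (/'-*-cancel d V≢0)
    Ld≡t : L * d ≡ t
    Ld≡t = trans (cong (L *_) (sym Vk≡d)) (/'-*-cancel t (subst (_≢ 0ℚ) (sym Vk≡d) d≢0))
    distribute : ∀ V d L k c → (V * d) * ((V + L) - c * k) ≡ V * V * d + V * (L * d) - c * (d * (V * k))
    distribute = solve 5 (λ V d L k c →
      (V :* d) :* ((V :+ L) :- c :* k) := V :* V :* d :+ V :* (L :* d) :- c :* (d :* (V :* k))) refl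
    expand : (V * d) * ((V + L) - c * k) ≡ V * V * d + V * t - c * (d * d)
    expand = trans (distribute V d L k c) (cong₂ (λ x y → V * V * d + V * x - c * (d * y)) Ld≡t Vk≡d)

  v+λ̄-2k̄>0 : ∀ {v} (G : Graph v) → 0 ℕ.< v → 0 ℕ.< 2 ℕ.* numEdges G →
    2 ℕ.* ((2 ℕ.* numEdges G) ℕ.* (2 ℕ.* numEdges G)) ℕ.<
      v ℕ.* v ℕ.* (2 ℕ.* numEdges G) ℕ.+ v ℕ.* (6 ℕ.* numTriangles G) →
    0ℚ < (fromℕℚ v + lambdabar G) - fromℕℚ 2 * kbar G
  v+λ̄-2k̄>0 {v} G 0<v 0<D bound =
    0<V+t/d-c*d/V V d t (fromℕℚ 2) (fromℕℚ-≢0 0<v) (subst (_≢ 0ℚ) d≡ (fromℕℚ-≢0 0<D)) Vd≥0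
      (subst₂ _<_ lhs≡ rhs≡ (fromℕℚ-mono-< bound))
    where
    D = 2 ℕ.* numEdges G
    T = 6 ℕ.* numTriangles G
    V = fromℕℚ v
    d = fromℕℚ 2 * fromℕℚ (numEdges G)
    t = fromℕℚ 6 * fromℕℚ (numTriangles G)
    d≡ : fromℕℚ D ≡ d
    d≡ = fromℕℚ-* 2 (numEdges G)
    Vd≥0 : NonNegative (V * d)
    Vd≥0 = subst NonNegative (trans (fromℕℚ-* v D) (cong (V *_) d≡)) (fromℕℚ-nonNeg (v ℕ.* D))
    lhs≡ : fromℕℚ (2 ℕ.* (D ℕ.* D)) ≡ fromℕℚ 2 * (d * d)
    lhs≡ = trans (fromℕℚ-* 2 (D ℕ.* D)) (cong (fromℕℚ 2 *_) (trans (fromℕℚ-* D D) (cong₂ _*_ d≡ d≡)))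
    rhs≡ : fromℕℚ (v ℕ.* v ℕ.* D ℕ.+ v ℕ.* T) ≡ V * V * d + V * t
    rhs≡ = trans (fromℕℚ-+ (v ℕ.* v ℕ.* D) (v ℕ.* T))
      (cong₂ _+_ (trans (fromℕℚ-* (v ℕ.* v) D) (cong₂ _*_ (fromℕℚ-* v v) d≡))
                 (trans (fromℕℚ-* v T) (cong (V *_) (fromℕℚ-* 6 (numTriangles G)))))

open import Defs
open import Data.Nat using (ℕ; _≤_)
open import Relation.Nullary using (¬_)
open import Data.Rational using (0ℚ; _<_; _+_; _-_; _*_)

open import Data.Nat using (z<s)
open import Data.Nat.Properties using (<-≤-trans)
open import Data.Empty using (⊥-elim)
open import Relation.Nullary using (yes; no)
open Multipartite using (inducedK₂+K₁?; K₂+K₁-free⇒completeMultipartite)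
open Degrees using (2*numEdges>0; edge-triangle-inequality)
open Rationals using (v+λ̄-2k̄>0)

lemma2p18 : (v : ℕ) (G : Graph v) → 3 ≤ v → ¬ CompleteMultipartite G →
    0ℚ < (fromℕℚ v + lambdabar G) - fromℕℚ 2 * kbar G
lemma2p18 v G 3≤v ¬multipartite with inducedK₂+K₁? G
... | no  free    = ⊥-elim (¬multipartite (K₂+K₁-free⇒completeMultipartite G free))
... | yes induced = v+λ̄-2k̄>0 G (<-≤-trans z<s 3≤v)
                      (2*numEdges>0 G induced) (edge-triangle-inequality G induced)
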